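{- Let $\alpha\in\mathscr{D}$. Then $\alpha$ is a stable defect if and only if $\alpha$ is the smallest $\beta\in\mathscr{D}$ such that $\beta\equiv\alpha\pmod 1$ (i.e. $\beta-\alpha\in\mathbb{Z}$).
   Context: $\|n\|$ is the complexity of a positive integer $n$: the least number of $1$'s needed to write $n$ using $1$, $+$, $\times$ and parentheses; $\delta(n)=\|n\|-3\log_3 n$; $\mathscr{D}=\{\delta(n):n\ge1\}$. A positive integer $m$ is stable if $\|3^km\|=3k+\|m\|$ for every $k\ge1$. A stable defect is the defect $\delta(m)$ of a stable number $m$. -}

module Defs where

open import Data.Nat using (ℕ; _+_; _*_; _^_; _≤_)
open import Data.Product using (Σ; _×_; ∃₂)
open import Relation.Binary.PropositionalEquality using (_≡_)

data Expr : Set where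
  one : Expr
  _⊕_ : Expr → Expr → Expr
  _⊗_ : Expr → Expr → Expr

eval : Expr → ℕ
eval one = 1
eval (e ⊕ f) = eval e + eval f
eval (e ⊗ f) = eval e * eval f

ones : Expr → ℕ
ones one = 1
ones (e ⊕ f) = ones e + ones f
ones (e ⊗ f) = ones e + ones f

‖_‖≡_ : ℕ → ℕ → Set
‖ n ‖≡ c = (Σ Expr λ e → eval e ≡ n × ones e ≡ c)
         × (∀ e → eval e ≡ n → c ≤ ones e)

-- Defects δ(n) = ‖n‖ - 3 log₃ n are real numbers; we compare them exactly
-- after exponentiating with base 3 (multiplying out positive denominators):
--   δ(n) = δ(m)  ⇔  3^‖n‖ · m³ = 3^‖m‖ · n³
--   δ(n) ≤ δ(m)  ⇔  3^‖n‖ · m³ ≤ 3^‖m‖ · n³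
--   δ(n) - δ(m) = b - a ∈ ℤ  ⇔  3^a · 3^‖n‖ · m³ = 3^b · 3^‖m‖ · n³
DefectEq : ℕ → ℕ → Set
DefectEq n m = ∀ cn cm → ‖ n ‖≡ cn → ‖ m ‖≡ cm →
  3 ^ cn * m ^ 3 ≡ 3 ^ cm * n ^ 3

DefectLe : ℕ → ℕ → Set
DefectLe n m = ∀ cn cm → ‖ n ‖≡ cn → ‖ m ‖≡ cm →
  3 ^ cn * m ^ 3 ≤ 3 ^ cm * n ^ 3

DefectCongMod1 : ℕ → ℕ → Set
DefectCongMod1 n m = ∀ cn cm → ‖ n ‖≡ cn → ‖ m ‖≡ cm →
  ∃₂ λ a b → 3 ^ a * (3 ^ cn * m ^ 3) ≡ 3 ^ b * (3 ^ cm * n ^ 3)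

Stable : ℕ → Set
Stable m = ∀ k → 1 ≤ k → ∀ c → ‖ m ‖≡ c → ‖ 3 ^ k * m ‖≡ (3 * k + c)

{-# OPTIONS --safe #-}
module Submission where

-- The defects of m and b differ by an integer iff m³/b³ is an integral power
-- of 3, i.e. (3 being prime) iff one of m, b is 3^i times the other. Multiplying an
-- expression by 3 = 1+1+1 gives ‖3^i n‖ ≤ 3i + ‖n‖, i.e. δ(3^i n) ≤ δ(n), with equality
-- for all i exactly when n is stable. So a stable m has the least defect of its class
-- mod 1; conversely, if δ(a) is least in its class then δ(a) ≤ δ(3^k a) forces
-- ‖3^k a‖ = 3k + ‖a‖, so a itself is stable.

open import Defs
open import Data.List using (List; []; _∷_; _++_; cartesianProductWith; filter)
open import Data.List.Extrema.Nat using (argmin; argmin-all; f[argmin]≤v⁺)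
open import Data.List.Membership.Propositional using (_∈_; lose)
open import Data.List.Membership.Propositional.Properties
  using (∈-cartesianProductWith⁺; ∈-++⁺ˡ; ∈-++⁺ʳ; ∈-filter⁺)
open import Data.List.Relation.Unary.All.Properties using (all-filter)
open import Data.List.Relation.Unary.Any using (here; there)
open import Data.Nat
  using ( ℕ; zero; suc; _+_; _*_; _^_; _∸_; _≤_; _<_; _>_; _≟_; _≤?_; z≤n; s≤s
        ; NonZero; >-nonZero; NonTrivial; nonTrivial⇒≢1; nonTrivial⇒n>1 )
open import Data.Nat.Divisibility using (_∣_; _∣?_; divides; ∣1⇒≡1; m∣m*n; ∣m⇒∣m*n)
open import Data.Nat.Induction using (<-wellFounded)
open import Data.Nat.Primality
  using (Prime; prime?; euclidsLemma; prime⇒nonZero; prime⇒nonTrivial)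
open import Data.Nat.Properties
open import Algebra.Properties.CommutativeSemigroup *-commutativeSemigroup using (x∙yz≈y∙xz)
open import Data.Product using (Σ; ∃; ∃₂; _×_; _,_)
open import Data.Sum using (_⊎_; inj₁; inj₂; [_,_]′)
open import Function.Bundles using (_⇔_; mk⇔)
open import Induction.WellFounded using (Acc; acc)
open import Relation.Binary.PropositionalEquality
open import Relation.Nullary using (¬_; yes; no; contradiction)
open import Relation.Nullary.Decidable using (from-yes)

^-distribʳ-* : ∀ m n k → (m * n) ^ k ≡ m ^ k * n ^ k
^-distribʳ-* m n zero    = refl
^-distribʳ-* m n (suc k) =
  trans (cong (m * n *_) (^-distribʳ-* m n k)) ([m*n]*[o*p]≡[m*o]*[n*p] m n (m ^ k) (n ^ k))

p^[a+b]*n≡p^a*[p^b*n] : ∀ p a b n → p ^ (a + b) * n ≡ p ^ a * (p ^ b * n)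
p^[a+b]*n≡p^a*[p^b*n] p a b n =
  trans (cong (_* n) (^-distribˡ-+-* p a b)) (*-assoc (p ^ a) (p ^ b) n)

p^a*[p^s*n]^k≡p^[s*k+a]*n^k : ∀ p a s n k → p ^ a * (p ^ s * n) ^ k ≡ p ^ (s * k + a) * n ^ k
p^a*[p^s*n]^k≡p^[s*k+a]*n^k p a s n k = begin
  p ^ a * (p ^ s * n) ^ k        ≡⟨ cong (p ^ a *_) (^-distribʳ-* (p ^ s) n k) ⟩
  p ^ a * ((p ^ s) ^ k * n ^ k)  ≡⟨ cong (λ x → p ^ a * (x * n ^ k)) (^-*-assoc p s k) ⟩
  p ^ a * (p ^ (s * k) * n ^ k)  ≡⟨ sym (p^[a+b]*n≡p^a*[p^b*n] p a (s * k) (n ^ k)) ⟩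
  p ^ (a + s * k) * n ^ k        ≡⟨ cong (λ x → p ^ x * n ^ k) (+-comm a (s * k)) ⟩
  p ^ (s * k + a) * n ^ k        ∎
  where open ≡-Reasoning

p^t*n≡p^[t∸s]*[p^s*n] : ∀ p {s t} n → s ≤ t → p ^ t * n ≡ p ^ (t ∸ s) * (p ^ s * n)
p^t*n≡p^[t∸s]*[p^s*n] p {s} {t} n s≤t = begin
  p ^ t * n                  ≡⟨ cong (λ x → p ^ x * n) (sym (m∸n+n≡m s≤t)) ⟩
  p ^ (t ∸ s + s) * n        ≡⟨ p^[a+b]*n≡p^a*[p^b*n] p (t ∸ s) s n ⟩
  p ^ (t ∸ s) * (p ^ s * n)  ∎
  where open ≡-Reasoning

^-cancelˡ-≡ : ∀ k .{{_ : NonZero k}} {m n} → m ^ k ≡ n ^ k → m ≡ n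
^-cancelˡ-≡ k mᵏ≡nᵏ = ≤-antisym
  (≮⇒≥ (λ n<m → <⇒≢ (^-monoˡ-< k n<m) (sym mᵏ≡nᵏ)))
  (≮⇒≥ (λ m<n → <⇒≢ (^-monoˡ-< k m<n) mᵏ≡nᵏ))

^-cancelʳ-≤ : ∀ m → 1 < m → ∀ {n o} → m ^ n ≤ m ^ o → n ≤ o
^-cancelʳ-≤ m 1<m mⁿ≤mᵒ = ≮⇒≥ (λ o<n → <⇒≱ (^-monoʳ-< m 1<m o<n) mⁿ≤mᵒ)

cross-≡-≤-trans : ∀ {a₁ b₁ a₂ b₂ a₃ b₃} .{{_ : NonZero a₁}} →
  a₁ * b₂ ≡ a₂ * b₁ → a₁ * b₃ ≤ a₃ * b₁ → a₂ * b₃ ≤ a₃ * b₂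
cross-≡-≤-trans {a₁} {b₁} {a₂} {b₂} {a₃} {b₃} eq le = *-cancelˡ-≤ a₁ (begin
  a₁ * (a₂ * b₃)  ≡⟨ x∙yz≈y∙xz a₁ a₂ b₃ ⟩
  a₂ * (a₁ * b₃)  ≤⟨ *-monoʳ-≤ a₂ le ⟩
  a₂ * (a₃ * b₁)  ≡⟨ x∙yz≈y∙xz a₂ a₃ b₁ ⟩
  a₃ * (a₂ * b₁)  ≡⟨ cong (a₃ *_) (sym eq) ⟩
  a₃ * (a₁ * b₂)  ≡⟨ x∙yz≈y∙xz a₃ a₁ b₂ ⟩
  a₁ * (a₃ * b₂)  ∎)
  where open ≤-Reasoning

-- x / y = p^z for some integer z.
infix 4 _≈[_]_
_≈[_]_ : ℕ → ℕ → ℕ → Set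
x ≈[ p ] y = ∃₂ λ P Q → p ^ P * x ≡ p ^ Q * y

≈[]-sym : ∀ {p x y} → x ≈[ p ] y → y ≈[ p ] x
≈[]-sym (P , Q , eq) = Q , P , sym eq

≈[]-trans : ∀ {p x y z} → x ≈[ p ] y → y ≈[ p ] z → x ≈[ p ] z
≈[]-trans {p} {x} {y} {z} (P₁ , Q₁ , eq₁) (P₂ , Q₂ , eq₂) = P₂ + P₁ , Q₁ + Q₂ , (begin
  p ^ (P₂ + P₁) * x      ≡⟨ p^[a+b]*n≡p^a*[p^b*n] p P₂ P₁ x ⟩
  p ^ P₂ * (p ^ P₁ * x)  ≡⟨ cong (p ^ P₂ *_) eq₁ ⟩
  p ^ P₂ * (p ^ Q₁ * y)  ≡⟨ x∙yz≈y∙xz (p ^ P₂) (p ^ Q₁) y ⟩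
  p ^ Q₁ * (p ^ P₂ * y)  ≡⟨ cong (p ^ Q₁ *_) eq₂ ⟩
  p ^ Q₁ * (p ^ Q₂ * z)  ≡⟨ sym (p^[a+b]*n≡p^a*[p^b*n] p Q₁ Q₂ z) ⟩
  p ^ (Q₁ + Q₂) * z      ∎)
  where open ≡-Reasoning

p^c*x≈[p]x : ∀ p c x → (p ^ c * x) ≈[ p ] x
p^c*x≈[p]x p c x = 0 , c , *-identityˡ (p ^ c * x)

module _ {p : ℕ} (p-prime : Prime p) where

  private instance
    p-nonTrivial : NonTrivial p
    p-nonTrivial = prime⇒nonTrivial p-prime
    p-nonZero : NonZero p
    p-nonZero = prime⇒nonZero p-prime

  ∤⇒∤^ : ∀ {m} → ¬ p ∣ m → ∀ k → ¬ p ∣ m ^ k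
  ∤⇒∤^ p∤m zero    p∣1     = nonTrivial⇒≢1 (∣1⇒≡1 p∣1)
  ∤⇒∤^ p∤m (suc k) p∣m^1+k = [ p∤m , ∤⇒∤^ p∤m k ]′ (euclidsLemma _ _ p-prime p∣m^1+k)

  p^u*m≡p^v*n⇒m≡n : ∀ u v {m n} → ¬ p ∣ m → ¬ p ∣ n → p ^ u * m ≡ p ^ v * n → m ≡ n
  p^u*m≡p^v*n⇒m≡n zero    zero    {m} {n} _   _   eq =
    trans (sym (*-identityˡ m)) (trans eq (*-identityˡ n))
  p^u*m≡p^v*n⇒m≡n zero    (suc v) {m} {n} p∤m _   eq =
    contradiction (subst (p ∣_) (trans (sym eq) (*-identityˡ m)) (∣m⇒∣m*n n (m∣m*n (p ^ v)))) p∤m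
  p^u*m≡p^v*n⇒m≡n (suc u) zero    {m} {n} _   p∤n eq =
    contradiction (subst (p ∣_) (trans eq (*-identityˡ n)) (∣m⇒∣m*n m (m∣m*n (p ^ u)))) p∤n
  p^u*m≡p^v*n⇒m≡n (suc u) (suc v) {m} {n} p∤m p∤n eq = p^u*m≡p^v*n⇒m≡n u v p∤m p∤n
    (*-cancelˡ-≡ _ _ p (trans (sym (*-assoc p (p ^ u) m)) (trans eq (*-assoc p (p ^ v) n))))

  p-free-part : ∀ n .{{_ : NonZero n}} → ∃₂ λ s n′ → ¬ p ∣ n′ × n ≡ p ^ s * n′
  p-free-part n = go n (<-wellFounded n)
    where
    go : ∀ n .{{_ : NonZero n}} → Acc _<_ n → ∃₂ λ s n′ → ¬ p ∣ n′ × n ≡ p ^ s * n′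
    go n (acc rec) with p ∣? n
    ... | no  p∤n = 0 , n , p∤n , sym (*-identityˡ n)
    ... | yes (divides q refl)
      with go q {{m*n≢0⇒m≢0 q}} (rec (m<m*n q p {{m*n≢0⇒m≢0 q}} (nonTrivial⇒n>1 p)))
    ...   | s , q′ , p∤q′ , refl = suc s , q′ , p∤q′ , (begin
      p ^ s * q′ * p    ≡⟨ *-comm (p ^ s * q′) p ⟩
      p * (p ^ s * q′)  ≡⟨ sym (*-assoc p (p ^ s) q′) ⟩
      p ^ suc s * q′    ∎)
      where open ≡-Reasoning

  m^k≈[p]n^k⇒n≡p^i*m⊎m≡p^i*n : ∀ k .{{_ : NonZero k}} {m n} .{{_ : NonZero m}} .{{_ : NonZero n}} →
    m ^ k ≈[ p ] n ^ k → (∃ λ i → n ≡ p ^ i * m) ⊎ (∃ λ i → m ≡ p ^ i * n)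
  m^k≈[p]n^k⇒n≡p^i*m⊎m≡p^i*n k {m} {n} (P , Q , eq)
    with p-free-part m | p-free-part n
  ... | s , m′ , p∤m′ , refl | t , n′ , p∤n′ , refl
    with ^-cancelˡ-≡ k (p^u*m≡p^v*n⇒m≡n (s * k + P) (t * k + Q) (∤⇒∤^ p∤m′ k) (∤⇒∤^ p∤n′ k)
           (trans (sym (p^a*[p^s*n]^k≡p^[s*k+a]*n^k p P s m′ k))
                  (trans eq (p^a*[p^s*n]^k≡p^[s*k+a]*n^k p Q t n′ k))))
  ... | refl with ≤-total s t
  ... | inj₁ s≤t = inj₁ (t ∸ s , p^t*n≡p^[t∸s]*[p^s*n] p m′ s≤t)
  ... | inj₂ t≤s = inj₂ (s ∸ t , p^t*n≡p^[t∸s]*[p^s*n] p m′ t≤s)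

ones>0 : ∀ e → ones e > 0
ones>0 one     = s≤s z≤n
ones>0 (e ⊕ f) = <-≤-trans (ones>0 e) (m≤m+n (ones e) (ones f))
ones>0 (e ⊗ f) = <-≤-trans (ones>0 e) (m≤m+n (ones e) (ones f))

operands-≤ : ∀ {n} e f → ones e + ones f ≤ suc n → ones e ≤ n × ones f ≤ n
operands-≤ e f h = ≤-pred (<-≤-trans (m<m+n (ones e) (ones>0 f)) h)
                 , ≤-pred (<-≤-trans (m<n+m (ones f) (ones>0 e)) h)

exprs≤ : ℕ → List Expr
exprs≤ zero    = []
exprs≤ (suc n) = one ∷ cartesianProductWith _⊕_ (exprs≤ n) (exprs≤ n)
                    ++ cartesianProductWith _⊗_ (exprs≤ n) (exprs≤ n)

∈-exprs≤ : ∀ {n} e → ones e ≤ n → e ∈ exprs≤ n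
∈-exprs≤ {zero}  e       h = contradiction h (<⇒≱ (ones>0 e))
∈-exprs≤ {suc n} one     _ = here refl
∈-exprs≤ {suc n} (e ⊕ f) h with operands-≤ e f h
... | e≤n , f≤n = there (∈-++⁺ˡ (∈-cartesianProductWith⁺ _⊕_ (∈-exprs≤ e e≤n) (∈-exprs≤ f f≤n)))
∈-exprs≤ {suc n} (e ⊗ f) h with operands-≤ e f h
... | e≤n , f≤n = there (∈-++⁺ʳ _ (∈-cartesianProductWith⁺ _⊗_ (∈-exprs≤ e e≤n) (∈-exprs≤ f f≤n)))

unary : ℕ → Expr
unary zero    = one
unary (suc n) = one ⊕ unary n

eval-unary : ∀ n → eval (unary n) ≡ suc n
eval-unary zero    = refl
eval-unary (suc n) = cong suc (eval-unary n)

ones-unary : ∀ n → ones (unary n) ≡ suc n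
ones-unary zero    = refl
ones-unary (suc n) = cong suc (ones-unary n)

-- A minimal expression for n uses at most n ones, so it occurs among exprs≤ n.
complexity-exists : ∀ n .{{_ : NonZero n}} → ∃ (‖ n ‖≡_)
complexity-exists n@(suc k) = ones best , (best , eval-best , refl) , best-minimal
  where
  candidates : List Expr
  candidates = filter (λ e → eval e ≟ n) (exprs≤ n)

  best : Expr
  best = argmin ones (unary k) candidates

  eval-best : eval best ≡ n
  eval-best = argmin-all ones (eval-unary k) (all-filter (λ e → eval e ≟ n) (exprs≤ n))

  best-minimal : ∀ e → eval e ≡ n → ones best ≤ ones e
  best-minimal e e≡n with ones e ≤? n
  ... | yes e≤n = f[argmin]≤v⁺ {f = ones} (unary k) candidates
                    (inj₂ (lose (∈-filter⁺ (λ e → eval e ≟ n) (∈-exprs≤ e e≤n) e≡n) ≤-refl))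
  ... | no  e≰n = f[argmin]≤v⁺ {f = ones} (unary k) candidates
                    (inj₁ (≤-trans (≤-reflexive (ones-unary k)) (<⇒≤ (≰⇒> e≰n))))

complexity-unique : ∀ {n c c′} → ‖ n ‖≡ c → ‖ n ‖≡ c′ → c ≡ c′
complexity-unique ((e , e≡n , refl) , e-min) ((e′ , e′≡n , refl) , e′-min) =
  ≤-antisym (e-min e′ e′≡n) (e′-min e e≡n)

times3^ : ℕ → Expr → Expr
times3^ zero    e = e
times3^ (suc k) e = ((one ⊕ one) ⊕ one) ⊗ times3^ k e

eval-times3^ : ∀ k e → eval (times3^ k e) ≡ 3 ^ k * eval e
eval-times3^ zero    e = sym (*-identityˡ (eval e))
eval-times3^ (suc k) e =
  trans (cong (3 *_) (eval-times3^ k e)) (sym (*-assoc 3 (3 ^ k) (eval e)))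

ones-times3^ : ∀ k e → ones (times3^ k e) ≡ 3 * k + ones e
ones-times3^ zero    e = refl
ones-times3^ (suc k) e = begin
  3 + ones (times3^ k e) ≡⟨ cong (3 +_) (ones-times3^ k e) ⟩
  3 + (3 * k + ones e)   ≡⟨ sym (+-assoc 3 (3 * k) (ones e)) ⟩
  3 + 3 * k + ones e     ≡⟨ cong (_+ ones e) (sym (*-suc 3 k)) ⟩
  3 * suc k + ones e     ∎
  where open ≡-Reasoning

complexity-3^*-≤ : ∀ k {n c c′} → ‖ n ‖≡ c → ‖ 3 ^ k * n ‖≡ c′ → c′ ≤ 3 * k + c
complexity-3^*-≤ k ((e , refl , refl) , _) (_ , minimal) =
  subst (_ ≤_) (ones-times3^ k e) (minimal (times3^ k e) (eval-times3^ k e))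

stable-complexity : ∀ {m c} → Stable m → ‖ m ‖≡ c → ∀ k → ‖ 3 ^ k * m ‖≡ (3 * k + c)
stable-complexity {m} {c} _      ‖m‖ zero      = subst (‖_‖≡ c) (sym (*-identityˡ m)) ‖m‖
stable-complexity         stable ‖m‖ k@(suc _) = stable k (s≤s z≤n) _ ‖m‖

stable-intro : ∀ {m} .{{_ : NonZero m}} →
  (∀ k {c c′} → ‖ m ‖≡ c → ‖ 3 ^ k * m ‖≡ c′ → 3 * k + c ≤ c′) → Stable m
stable-intro {m} no-drop k _ c ‖m‖
  with complexity-exists (3 ^ k * m) {{m*n≢0 (3 ^ k) m {{m^n≢0 3 k}}}}
... | c′ , ‖3^km‖ = subst (‖ 3 ^ k * m ‖≡_)
  (≤-antisym (complexity-3^*-≤ k ‖m‖ ‖3^km‖) (no-drop k ‖m‖ ‖3^km‖)) ‖3^km‖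

3^c*[3^k*n]^3≡3^[3k+c]*n^3 : ∀ c k n → 3 ^ c * (3 ^ k * n) ^ 3 ≡ 3 ^ (3 * k + c) * n ^ 3
3^c*[3^k*n]^3≡3^[3k+c]*n^3 c k n = trans (p^a*[p^s*n]^k≡p^[s*k+a]*n^k 3 c k n 3)
                                          (cong (λ x → 3 ^ (x + c) * n ^ 3) (*-comm k 3))

prime[3] : Prime 3
prime[3] = from-yes (prime? 3)

defectCongMod1⇒cubes≈ : ∀ {n m cn cm} → ‖ n ‖≡ cn → ‖ m ‖≡ cm →
  DefectCongMod1 n m → m ^ 3 ≈[ 3 ] n ^ 3
defectCongMod1⇒cubes≈ {n} {m} {cn} {cm} ‖n‖ ‖m‖ δn≡δm =
  ≈[]-trans (≈[]-sym (p^c*x≈[p]x 3 cn (m ^ 3)))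
            (≈[]-trans (δn≡δm cn cm ‖n‖ ‖m‖) (p^c*x≈[p]x 3 cm (n ^ 3)))

defectCongMod1-3^k* : ∀ k n → DefectCongMod1 (3 ^ k * n) n
defectCongMod1-3^k* k n c c′ _ _ =
  ≈[]-trans (p^c*x≈[p]x 3 c (n ^ 3))
            (≈[]-trans n³≈[3^k*n]³ (≈[]-sym (p^c*x≈[p]x 3 c′ ((3 ^ k * n) ^ 3))))
  where
  n³≈[3^k*n]³ : n ^ 3 ≈[ 3 ] (3 ^ k * n) ^ 3
  n³≈[3^k*n]³ = 3 * k + 0 , 0 , sym (3^c*[3^k*n]^3≡3^[3k+c]*n^3 0 k n)

defectEq-refl : ∀ n → DefectEq n n
defectEq-refl n c c′ ‖n‖≡c ‖n‖≡c′ rewrite complexity-unique ‖n‖≡c ‖n‖≡c′ = refl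

3^c*[3^k*n]^3≤3^c′*n^3⇒3k+c≤c′ : ∀ {c c′ k n} .{{_ : NonZero n}} →
  3 ^ c * (3 ^ k * n) ^ 3 ≤ 3 ^ c′ * n ^ 3 → 3 * k + c ≤ c′
3^c*[3^k*n]^3≤3^c′*n^3⇒3k+c≤c′ {c} {c′} {k} {n} le =
  ^-cancelʳ-≤ 3 (s≤s (s≤s z≤n)) (*-cancelʳ-≤ _ _ (n ^ 3) {{m^n≢0 n 3}}
    (subst (_≤ 3 ^ c′ * n ^ 3) (3^c*[3^k*n]^3≡3^[3k+c]*n^3 c k n) le))

stable⇒defect-minimal : ∀ {m b cm cb} .{{_ : NonZero m}} .{{_ : NonZero b}} → Stable m →
  ‖ m ‖≡ cm → ‖ b ‖≡ cb → m ^ 3 ≈[ 3 ] b ^ 3 → 3 ^ cm * b ^ 3 ≤ 3 ^ cb * m ^ 3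
stable⇒defect-minimal {m} {b} {cm} {cb} stable ‖m‖ ‖b‖ m³≈b³
  with m^k≈[p]n^k⇒n≡p^i*m⊎m≡p^i*n prime[3] 3 m³≈b³
... | inj₁ (i , refl) = ≤-reflexive (begin
  3 ^ cm * (3 ^ i * m) ^ 3    ≡⟨ 3^c*[3^k*n]^3≡3^[3k+c]*n^3 cm i m ⟩
  3 ^ (3 * i + cm) * m ^ 3    ≡⟨ cong (λ c → 3 ^ c * m ^ 3) 3i+cm≡cb ⟩
  3 ^ cb * m ^ 3              ∎)
  where
  open ≡-Reasoning
  3i+cm≡cb : 3 * i + cm ≡ cb
  3i+cm≡cb = complexity-unique (stable-complexity stable ‖m‖ i) ‖b‖
... | inj₂ (i , refl) = begin
  3 ^ cm * b ^ 3              ≤⟨ *-monoˡ-≤ (b ^ 3) (^-monoʳ-≤ 3 (complexity-3^*-≤ i ‖b‖ ‖m‖)) ⟩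
  3 ^ (3 * i + cb) * b ^ 3    ≡⟨ sym (3^c*[3^k*n]^3≡3^[3k+c]*n^3 cb i b) ⟩
  3 ^ cb * (3 ^ i * b) ^ 3    ∎
  where open ≤-Reasoning

proposition3p3 : ∀ (a : ℕ) → 1 ≤ a →
    (Σ ℕ λ m → 1 ≤ m × Stable m × DefectEq m a)
      ⇔ (∀ (b : ℕ) → 1 ≤ b → DefectCongMod1 b a → DefectLe a b)
proposition3p3 a a≥1 = mk⇔ stable⇒minimal minimal⇒stable
  where
  stable⇒minimal : (Σ ℕ λ m → 1 ≤ m × Stable m × DefectEq m a) →
                   ∀ b → 1 ≤ b → DefectCongMod1 b a → DefectLe a b
  stable⇒minimal (m , m≥1 , stable , δm≡δa) b b≥1 δb≡δa ca cb ‖a‖ ‖b‖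
    with complexity-exists m {{>-nonZero m≥1}}
  ... | cm , ‖m‖ =
    cross-≡-≤-trans {a₂ = 3 ^ ca} {a₃ = 3 ^ cb} {{m^n≢0 3 cm}} (δm≡δa cm ca ‖m‖ ‖a‖)
    (stable⇒defect-minimal {{>-nonZero m≥1}} {{>-nonZero b≥1}} stable ‖m‖ ‖b‖
      (≈[]-trans (≈[]-sym (cm , ca , δm≡δa cm ca ‖m‖ ‖a‖)) (defectCongMod1⇒cubes≈ ‖b‖ ‖a‖ δb≡δa)))

  minimal⇒stable : (∀ b → 1 ≤ b → DefectCongMod1 b a → DefectLe a b) →
                   Σ ℕ λ m → 1 ≤ m × Stable m × DefectEq m a
  minimal⇒stable δa-minimal = a , a≥1 , stable-intro {{>-nonZero a≥1}} no-drop , defectEq-refl a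
    where
    no-drop : ∀ k {c c′} → ‖ a ‖≡ c → ‖ 3 ^ k * a ‖≡ c′ → 3 * k + c ≤ c′
    no-drop k {c} {c′} ‖a‖ ‖3^ka‖ =
      3^c*[3^k*n]^3≤3^c′*n^3⇒3k+c≤c′ {c} {c′} {k} {{>-nonZero a≥1}}
      (δa-minimal (3 ^ k * a) (*-mono-≤ (m^n>0 3 k) a≥1) (defectCongMod1-3^k* k a) c c′ ‖a‖ ‖3^ka‖)
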